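{- Let $(G_x,\mathrm{lab}_x)$ be a multi-labeled graph, let $u,v$ be vertices of $G_x$, and let $\ell_u\ne\ell_v$ be labels such that for every vertex $w$ of $G_x$: $\mathrm{lab}_x(w)\cap\{\ell_u,\ell_v\}$ equals $\{\ell_u\}$ if $w=u$, equals $\{\ell_v\}$ if $w=v$, and is empty otherwise. Let $\mathcal{A}_x\subseteq\mathrm{aux}(G_x,\mathrm{lab}_x)$ satisfy $\mathcal{A}_x\lesssim\mathrm{aux}(G_x,\mathrm{lab}_x)$. Then $G_x$ contains a Hamiltonian path with endpoints $u$ and $v$ if and only if $\mathcal{A}_x$ contains a multigraph whose edge set consists of exactly one edge, and this edge has endpoints $\ell_u$ and $\ell_v$.
   Context: A multi-labeled graph is $(H,\mathrm{lab})$ with $\mathrm{lab}:V(H)\to2^{[k]}$ for the number $k$ of labels. A Hamiltonian path visits every vertex exactly once. A path packing of $H$ is a set of vertex-disjoint paths (possibly of length 0) covering all vertices. A label choice of a path packing $\mathcal{P}$ is a map $\phi:\mathcal{P}\to\binom{[k]}{1}\cup\binom{[k]}{2}$ such that for each path $P$ with endpoints $a',b'$ ($a'=b'$ iff $P$ has length 0), writing $\phi(P)=\{a,b\}$ (possibly $a=b$), we have $a\in\mathrm{lab}(a'),b\in\mathrm{lab}(b')$ or $a\in\mathrm{lab}(b'),b\in\mathrm{lab}(a')$. Multigraphs here have vertex set $[k]$, may have loops and parallel edges; two are equal if all pairs $\{a,b\}$ have equal multiplicities. $\mathrm{aux}(\mathcal{P},\phi)$ is the red multigraph with multiplicity of $\{a,b\}$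 equal to $|\phi^{ -1}(\{a,b\})|$, and $\mathrm{aux}(H,\mathrm{lab})$ is the set of all $\mathrm{aux}(\mathcal{P},\phi)$. $A\uplus B$ adds multiplicities. For a multigraph with red and blue edges and at least one edge, a red-blue Eulerian trail is a closed walk traversing every edge exactly once with alternating colors (first and last edges of different colors). $\mathcal{A}\lesssim\mathcal{B}$ means: for every blue multigraph $M$ on $[k]$, if some $B\in\mathcal{B}$ makes $B\uplus M$ admit a red-blue Eulerian trail, then some $A\in\mathcal{A}$ makes $A\uplus M$ admit one. -}

module Defs where

open import Data.Nat using (ℕ; zero; suc)
open import Data.Bool using (Bool; true; false; _∧_; _∨_; if_then_else_)
open import Data.Fin using (Fin; _≟_)
open import Data.Fin.Subset using (Subset; _∈_; _∉_)
open import Data.List using (List; []; _∷_; _++_; map; concat)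
open import Data.List.NonEmpty using (List⁺; toList; head; last)
open import Data.List.Relation.Unary.All using (All)
open import Data.List.Relation.Unary.Linked using (Linked)
open import Data.List.Relation.Binary.Pointwise using (Pointwise)
open import Data.List.Relation.Binary.Permutation.Propositional using (_↭_)
open import Data.List using (allFin)
open import Data.Product using (Σ; _×_; _,_; ∃; proj₁; proj₂)
open import Data.Sum using (_⊎_)
open import Data.Unit using (⊤)
open import Relation.Nullary using (¬_)
open import Relation.Nullary.Decidable using (⌊_⌋)
open import Relation.Binary.PropositionalEquality using (_≡_; _≢_)

record Graph (n : ℕ) : Set₁ where
  field
    Adj     : Fin n → Fin n → Set
    sym     : ∀ {x y} → Adj x y → Adj y x
    irrefl  : ∀ {x} → ¬ Adj x x
open Graph public

Labelling : ℕ → ℕ → Set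
Labelling n k = Fin n → Subset k

-- A path: nonempty vertex sequence, consecutive vertices adjacent.
-- (Distinctness of vertices is enforced where paths are used.)
IsPath : ∀ {n} → Graph n → List⁺ (Fin n) → Set
IsPath G p = Linked (Adj G) (toList p)

HamPath : ∀ {n} → Graph n → Fin n → Fin n → Set
HamPath {n} G u v = Σ (List⁺ (Fin n)) λ p →
  IsPath G p × (toList p ↭ allFin n) × head p ≡ u × last p ≡ v

IsPacking : ∀ {n} → Graph n → List (List⁺ (Fin n)) → Set
IsPacking {n} G ps = All (IsPath G) ps × (concat (map toList ps) ↭ allFin n)

-- Multigraphs on [k] as edge lists (loops / parallel edges allowed).
Edge : ℕ → Set
Edge k = Fin k × Fin k

MG : ℕ → Set
MG k = List (Edge k)

sameEdge : ∀ {k} → Fin k → Fin k → Edge k → Bool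
sameEdge a b (x , y) = (⌊ a ≟ x ⌋ ∧ ⌊ b ≟ y ⌋) ∨ (⌊ a ≟ y ⌋ ∧ ⌊ b ≟ x ⌋)

mult : ∀ {k} → MG k → Fin k → Fin k → ℕ
mult [] a b = zero
mult (e ∷ es) a b = if sameEdge a b e then suc (mult es a b) else mult es a b

_≈ᴹ_ : ∀ {k} → MG k → MG k → Set
M ≈ᴹ N = ∀ a b → mult M a b ≡ mult N a b

-- Label choice: phi(P) = {a,b} with a ∈ lab(one endpoint), b ∈ lab(the other).
-- Stored as ordered pairs (a,b) with a ∈ lab(first vertex), b ∈ lab(last vertex);
-- aux(P, phi) is then the list of these pairs as red edges.
IsLabelChoice : ∀ {n k} → Labelling n k → List (List⁺ (Fin n)) → MG k → Set
IsLabelChoice lab ps φ =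
  Pointwise (λ p e → proj₁ e ∈ lab (head p) × proj₂ e ∈ lab (last p)) ps φ

InAux : ∀ {n k} → Graph n → Labelling n k → MG k → Set
InAux {n} {k} G lab M = Σ (List (List⁺ (Fin n))) λ ps → Σ (MG k) λ φ →
  IsPacking G ps × IsLabelChoice lab ps φ × φ ≈ᴹ M

data Color : Set where
  red blue : Color

CEdge : ℕ → Set
CEdge k = Color × Fin k × Fin k

_⊎ᴿᴮ_ : ∀ {k} → MG k → MG k → List (CEdge k)
A ⊎ᴿᴮ M = map (red ,_) A ++ map (blue ,_) M

Flip : ∀ {k} → CEdge k → CEdge k → Set
Flip (c , x , y) (c' , x' , y') = c ≡ c' × ((x ≡ x' × y ≡ y') ⊎ (x ≡ y' × y ≡ x'))

-- Steps (c, from, to) of a walk: consecutive steps chain and alternate colours.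
AltChain : ∀ {k} → List (CEdge k) → Set
AltChain [] = ⊤
AltChain (s ∷ []) = ⊤
AltChain ((c , x , y) ∷ (c' , x' , y') ∷ r) = y ≡ x' × c ≢ c' × AltChain ((c' , x' , y') ∷ r)

lastStep : ∀ {k} → CEdge k → List (CEdge k) → CEdge k
lastStep s [] = s
lastStep s (t ∷ r) = lastStep t r

ClosedAltWalk : ∀ {k} → List (CEdge k) → Set
ClosedAltWalk [] = Data.Empty.⊥
  where import Data.Empty
ClosedAltWalk ((c , x , y) ∷ r) with lastStep (c , x , y) r
... | (c' , x' , y') = AltChain ((c , x , y) ∷ r) × y' ≡ x × c' ≢ c

HasRBEulerTrail : ∀ {k} → List (CEdge k) → Set
HasRBEulerTrail {k} E = Σ (List (CEdge k)) λ T → Σ (List (CEdge k)) λ E' →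
  Pointwise Flip E E' × T ↭ E' × ClosedAltWalk T

_≲_ : ∀ {k} → (MG k → Set) → (MG k → Set) → Set
_≲_ {k} 𝓐 𝓑 = ∀ (M : MG k) →
  (Σ (MG k) λ B → 𝓑 B × HasRBEulerTrail (B ⊎ᴿᴮ M)) →
  (Σ (MG k) λ A → 𝓐 A × HasRBEulerTrail (A ⊎ᴿᴮ M))

LabelCond : ∀ {n k} → Labelling n k → Fin n → Fin n → Fin k → Fin k → Set
LabelCond {n} lab u v ℓu ℓv = ∀ (w : Fin n) →
  (w ≡ u → ℓu ∈ lab w × ℓv ∉ lab w) ×
  (w ≡ v → ℓv ∈ lab w × ℓu ∉ lab w) ×
  (w ≢ u → w ≢ v → ℓu ∉ lab w × ℓv ∉ lab w)

-- A Hamiltonian u–v path is a packing by one path, and choosing the labels ℓu, ℓv at its ends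
-- puts the single red edge ℓuℓv into aux.  Together with a blue copy of that edge it has a
-- two-step red-blue Eulerian trail, so by 𝓐 ≲ aux some A ∈ 𝓐 has a trail together with the
-- single blue edge ℓuℓv.  A closed alternating walk using only one blue edge goes along an
-- edge and straight back, so A is the single edge ℓuℓv.  Conversely, a member of 𝓐 ⊆ aux
-- that is the single edge ℓuℓv comes from a packing by one path whose ends carry ℓu and ℓv;
-- by the label condition these ends are u and v, and reversing the path if needed gives a
-- Hamiltonian u–v path.
module Submission where

open import Defs
open import Data.Nat using (ℕ)
open import Data.Fin using (Fin)
open import Data.List using (List; []; _∷_)
open import Data.Product using (Σ; _×_; _,_)
open import Function.Bundles using (_⇔_)
open import Relation.Binary.PropositionalEquality using (_≢_)

open import Data.Bool using (T; true; false; _∧_; if_then_else_)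
open import Data.Bool.Properties using (T-∧; T-∨; T-≡; ∨-comm)
open import Data.Empty using (⊥; ⊥-elim)
open import Data.Fin using (_≟_)
open import Data.Fin.Subset using (_∈_)
open import Data.List using (_++_; length; initLast; _∷ʳ′_; allFin)
open import Data.List.Properties using (++-identityʳ)
open import Data.List.NonEmpty using (List⁺; _∷_; _∷⁺_; head; last; toList)
open import Data.List.Membership.Propositional using () renaming (_∈_ to _∈ₗ_)
open import Data.List.Relation.Unary.All as All using (All; []; _∷_)
open import Data.List.Relation.Unary.Any using (here; there)
open import Data.List.Relation.Unary.Linked using (Linked; [-]; _∷_)
open import Data.List.Relation.Binary.Pointwise using (Pointwise; []; _∷_)
open import Data.List.Relation.Binary.Permutation.Propositional
  using (_↭_; refl; prep; swap; trans; ↭-refl; ↭-sym; ↭-trans; ↭-reflexive)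
open import Data.List.Relation.Binary.Permutation.Propositional.Properties
  using (shift; ↭-length; ∈-resp-↭)
open import Data.Nat using (suc; _≤_; _<_; z≤n; s≤s)
open import Data.Nat.Properties using (≤-refl; ≤-trans; n≤1+n)
open import Data.Product using (proj₁; proj₂)
import Data.Product as Product
open import Data.Sum using (_⊎_; inj₁; inj₂)
import Data.Sum as Sum
open import Data.Unit using (tt)
open import Function.Base using (_∘_)
open import Function.Bundles using (Equivalence; mk⇔)
open import Relation.Nullary using (Dec; yes; no; contradiction)
open import Relation.Nullary.Decidable using (⌊_⌋; toWitness; fromWitness)
open import Relation.Binary.PropositionalEquality using (_≡_; refl; cong; subst; subst₂)
import Relation.Binary.PropositionalEquality as ≡

open Equivalence using (to; from)

_≈ᵉ_ : ∀ {k} → Edge k → Edge k → Set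
(a , b) ≈ᵉ (x , y) = (a ≡ x × b ≡ y) ⊎ (a ≡ y × b ≡ x)

≈ᵉ-refl : ∀ {k} {a b : Fin k} → (a , b) ≈ᵉ (a , b)
≈ᵉ-refl = inj₁ (refl , refl)

≈ᵉ-sym : ∀ {k} {a b x y : Fin k} → (a , b) ≈ᵉ (x , y) → (x , y) ≈ᵉ (a , b)
≈ᵉ-sym (inj₁ (refl , refl)) = inj₁ (refl , refl)
≈ᵉ-sym (inj₂ (refl , refl)) = inj₂ (refl , refl)

≈ᵉ-trans : ∀ {k} {a b c d x y : Fin k} →
  (a , b) ≈ᵉ (c , d) → (c , d) ≈ᵉ (x , y) → (a , b) ≈ᵉ (x , y)
≈ᵉ-trans (inj₁ (refl , refl)) (inj₁ (refl , refl)) = inj₁ (refl , refl)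
≈ᵉ-trans (inj₁ (refl , refl)) (inj₂ (refl , refl)) = inj₂ (refl , refl)
≈ᵉ-trans (inj₂ (refl , refl)) (inj₁ (refl , refl)) = inj₂ (refl , refl)
≈ᵉ-trans (inj₂ (refl , refl)) (inj₂ (refl , refl)) = inj₁ (refl , refl)

sameEdge-sound : ∀ {k} {a b : Fin k} e → T (sameEdge a b e) → (a , b) ≈ᵉ e
sameEdge-sound {a = a} {b} (x , y) t =
  Sum.map (both (a ≟ x) (b ≟ y)) (both (a ≟ y) (b ≟ x)) (to (T-∨ {⌊ a ≟ x ⌋ ∧ ⌊ b ≟ y ⌋}) t)
  where
  both : ∀ {P Q : Set} (p? : Dec P) (q? : Dec Q) → T (⌊ p? ⌋ ∧ ⌊ q? ⌋) → P × Q
  both p? q? t = Product.map (toWitness {a? = p?}) (toWitness {a? = q?}) (to (T-∧ {⌊ p? ⌋}) t)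

sameEdge-complete : ∀ {k} {a b : Fin k} e → (a , b) ≈ᵉ e → T (sameEdge a b e)
sameEdge-complete {a = a} {b} (x , y) s =
  from (T-∨ {⌊ a ≟ x ⌋ ∧ ⌊ b ≟ y ⌋}) (Sum.map (both (a ≟ x) (b ≟ y)) (both (a ≟ y) (b ≟ x)) s)
  where
  both : ∀ {P Q : Set} (p? : Dec P) (q? : Dec Q) → P × Q → T (⌊ p? ⌋ ∧ ⌊ q? ⌋)
  both p? q? (p , q) = from (T-∧ {⌊ p? ⌋}) (fromWitness {a? = p?} p , fromWitness {a? = q?} q)

sameEdge-resp-≈ᵉ : ∀ {k} {a b x y c d : Fin k} →
  (x , y) ≈ᵉ (c , d) → sameEdge a b (x , y) ≡ sameEdge a b (c , d)
sameEdge-resp-≈ᵉ (inj₁ (refl , refl)) = refl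
sameEdge-resp-≈ᵉ {a = a} {b} {x} {y} (inj₂ (refl , refl)) =
  ∨-comm (⌊ a ≟ x ⌋ ∧ ⌊ b ≟ y ⌋) (⌊ a ≟ y ⌋ ∧ ⌊ b ≟ x ⌋)

≈ᵉ⇒singleton-≈ᴹ : ∀ {k} {e e′ : Edge k} → e ≈ᵉ e′ → (e ∷ []) ≈ᴹ (e′ ∷ [])
≈ᵉ⇒singleton-≈ᴹ {e = _ , _} {_ , _} e≈e′ a b =
  cong (λ s → if s then 1 else 0) (sameEdge-resp-≈ᵉ {a = a} {b} e≈e′)

mult-∷-≈ᵉ : ∀ {k} {a b : Fin k} {e} φ → (a , b) ≈ᵉ e → mult (e ∷ φ) a b ≡ suc (mult φ a b)
mult-∷-≈ᵉ {a = a} {b} {e} φ ab≈e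
  rewrite to (T-≡ {sameEdge a b e}) (sameEdge-complete e ab≈e) = refl

mult-≤-∷ : ∀ {k} {a b : Fin k} e φ → mult φ a b ≤ mult (e ∷ φ) a b
mult-≤-∷ {a = a} {b} e φ with sameEdge a b e
... | true  = n≤1+n _
... | false = ≤-refl

∈⇒mult>0 : ∀ {k} {x y : Fin k} {φ} → (x , y) ∈ₗ φ → 0 < mult φ x y
∈⇒mult>0 {φ = _ ∷ φ} (here refl) = subst (0 <_) (≡.sym (mult-∷-≈ᵉ φ ≈ᵉ-refl)) (s≤s z≤n)
∈⇒mult>0 {φ = e ∷ φ} (there x∈) = ≤-trans (∈⇒mult>0 x∈) (mult-≤-∷ e φ)

singleton-mult>0⇒≈ᵉ : ∀ {k} {a b : Fin k} e → 0 < mult (e ∷ []) a b → (a , b) ≈ᵉ e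
singleton-mult>0⇒≈ᵉ {a = a} {b} e m>0 with sameEdge a b e in eq
... | true  = sameEdge-sound e (from T-≡ eq)
... | false = contradiction m>0 λ ()

All≈ᵉ⇒mult≡length : ∀ {k} {a b : Fin k} {φ} → All ((a , b) ≈ᵉ_) φ → mult φ a b ≡ length φ
All≈ᵉ⇒mult≡length []                   = refl
All≈ᵉ⇒mult≡length {φ = _ ∷ φ} (s ∷ ss) = ≡.trans (mult-∷-≈ᵉ φ s) (cong suc (All≈ᵉ⇒mult≡length ss))

≈ᴹ-singleton-inv : ∀ {k} {e : Edge k} {φ} → φ ≈ᴹ (e ∷ []) → Σ (Edge k) λ e′ → φ ≡ e′ ∷ [] × e ≈ᵉ e′
-- Every edge of φ is counted by mult (e ∷ []), hence ≈ᵉ e; then mult φ at e counts all of φ.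
≈ᴹ-singleton-inv {e = p , q} {φ} φ≈ = singleton φ All≈ length≡1
  where
  All≈ : All ((p , q) ≈ᵉ_) φ
  All≈ = All.tabulate λ {(x , y)} x∈ →
    ≈ᵉ-sym (singleton-mult>0⇒≈ᵉ (p , q) (subst (0 <_) (φ≈ x y) (∈⇒mult>0 x∈)))
  length≡1 : length φ ≡ 1
  length≡1 = ≡.trans (≡.sym (All≈ᵉ⇒mult≡length All≈))
                     (≡.trans (φ≈ p q) (mult-∷-≈ᵉ [] (≈ᵉ-refl {a = p} {q})))
  singleton : ∀ ψ → All ((p , q) ≈ᵉ_) ψ → length ψ ≡ 1 →
              Σ (Edge _) λ e′ → ψ ≡ e′ ∷ [] × (p , q) ≈ᵉ e′
  singleton (e′ ∷ []) (s ∷ []) _ = e′ , refl , s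

#blue : ∀ {k} → List (CEdge k) → ℕ
#blue []               = 0
#blue ((red  , _) ∷ s) = #blue s
#blue ((blue , _) ∷ s) = suc (#blue s)

#blue-↭ : ∀ {k} {s t : List (CEdge k)} → s ↭ t → #blue s ≡ #blue t
#blue-↭ refl                              = refl
#blue-↭ (prep (red  , _) s↭t)             = #blue-↭ s↭t
#blue-↭ (prep (blue , _) s↭t)             = cong suc (#blue-↭ s↭t)
#blue-↭ (swap (red  , _) (red  , _) s↭t) = #blue-↭ s↭t
#blue-↭ (swap (red  , _) (blue , _) s↭t) = cong suc (#blue-↭ s↭t)
#blue-↭ (swap (blue , _) (red  , _) s↭t) = cong suc (#blue-↭ s↭t)
#blue-↭ (swap (blue , _) (blue , _) s↭t) = cong (suc ∘ suc) (#blue-↭ s↭t)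
#blue-↭ (trans s↭r r↭t)                   = ≡.trans (#blue-↭ s↭r) (#blue-↭ r↭t)

#blue-flip : ∀ {k} {s t : List (CEdge k)} → Pointwise Flip s t → #blue s ≡ #blue t
#blue-flip []                                             = refl
#blue-flip {s = (red  , _) ∷ _} {_ ∷ _} ((refl , _) ∷ fs) = #blue-flip fs
#blue-flip {s = (blue , _) ∷ _} {_ ∷ _} ((refl , _) ∷ fs) = cong suc (#blue-flip fs)

#blue-⊎ᴿᴮ : ∀ {k} (A M : MG k) → #blue (A ⊎ᴿᴮ M) ≡ length M
#blue-⊎ᴿᴮ (_ ∷ A) M  = #blue-⊎ᴿᴮ A M
#blue-⊎ᴿᴮ [] []      = refl
#blue-⊎ᴿᴮ [] (_ ∷ M) = cong suc (#blue-⊎ᴿᴮ [] M)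

#blue-alternatingPair : ∀ {k} {c c′ : Color} {e e′ : Fin k × Fin k} s →
  c ≢ c′ → #blue ((c , e) ∷ (c′ , e′) ∷ s) ≡ suc (#blue s)
#blue-alternatingPair {c = red}  {red}  _ c≢c′ = contradiction refl c≢c′
#blue-alternatingPair {c = red}  {blue} _ _    = refl
#blue-alternatingPair {c = blue} {red}  _ _    = refl
#blue-alternatingPair {c = blue} {blue} _ c≢c′ = contradiction refl c≢c′

no-three-distinct-colours : ∀ {c₁ c₂ c₃ : Color} → c₁ ≢ c₂ → c₂ ≢ c₃ → c₃ ≢ c₁ → ⊥
no-three-distinct-colours {red}  {red}           c₁≢c₂ _     _     = c₁≢c₂ refl
no-three-distinct-colours {blue} {blue}          c₁≢c₂ _     _     = c₁≢c₂ refl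
no-three-distinct-colours {red}  {blue} {red}  _     _     c₃≢c₁ = c₃≢c₁ refl
no-three-distinct-colours {red}  {blue} {blue} _     c₂≢c₃ _     = c₂≢c₃ refl
no-three-distinct-colours {blue} {red}  {red}  _     c₂≢c₃ _     = c₂≢c₃ refl
no-three-distinct-colours {blue} {red}  {blue} _     _     c₃≢c₁ = c₃≢c₁ refl

closedAltWalk⇒altChain : ∀ {k} (T : List (CEdge k)) → ClosedAltWalk T → AltChain T
closedAltWalk⇒altChain (s ∷ r) walk with lastStep s r
... | _ = proj₁ walk

closedAltWalk-oneBlue⇒thereAndBack : ∀ {k} (T : List (CEdge k)) → ClosedAltWalk T → #blue T ≡ 1 →
  Σ Color λ c → Σ Color λ c′ → Σ (Fin k) λ x → Σ (Fin k) λ y →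
  T ≡ (c , x , y) ∷ (c′ , y , x) ∷ [] × c ≢ c′
closedAltWalk-oneBlue⇒thereAndBack (_ ∷ []) (_ , _ , c≢c) _ = contradiction refl c≢c
closedAltWalk-oneBlue⇒thereAndBack ((c , x , y) ∷ (c′ , _) ∷ []) ((refl , c≢c′ , _) , refl , _) _ =
  c , c′ , x , y , refl , c≢c′
closedAltWalk-oneBlue⇒thereAndBack (_ ∷ _ ∷ _ ∷ []) ((_ , c₁≢c₂ , _ , c₂≢c₃ , _) , _ , c₃≢c₁) _ =
  ⊥-elim (no-three-distinct-colours c₁≢c₂ c₂≢c₃ c₃≢c₁)
-- Each pair of consecutive steps contains exactly one blue step, so four steps contain two.
closedAltWalk-oneBlue⇒thereAndBack T@(_ ∷ _ ∷ s₃ ∷ s₄ ∷ r) walk one-blue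
  with closedAltWalk⇒altChain T walk
... | _ , c₁≢c₂ , _ , _ , _ , c₃≢c₄ , _ =
  contradiction (≡.trans (≡.sym two-blues) one-blue) λ ()
  where
  two-blues : #blue T ≡ suc (suc (#blue r))
  two-blues = ≡.trans (#blue-alternatingPair (s₃ ∷ s₄ ∷ r) c₁≢c₂)
                      (cong suc (#blue-alternatingPair r c₃≢c₄))

thereAndBack-↭-redBlue⇒≈ᵉ : ∀ {k} {c c′ : Color} {x y : Fin k} {r b} → c ≢ c′ →
  ((c , x , y) ∷ (c′ , y , x) ∷ []) ↭ ((red , r) ∷ (blue , b) ∷ []) → r ≈ᵉ b
thereAndBack-↭-redBlue⇒≈ᵉ c≢c′ T↭E′ =
  go c≢c′ (∈-resp-↭ T↭E′ (here refl)) (∈-resp-↭ T↭E′ (there (here refl)))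
  where
  go : ∀ {k} {c c′ : Color} {x y : Fin k} {r b} → c ≢ c′ →
    (c , x , y) ∈ₗ (red , r) ∷ (blue , b) ∷ [] → (c′ , y , x) ∈ₗ (red , r) ∷ (blue , b) ∷ [] → r ≈ᵉ b
  go c≢c′ (here refl)         (here refl)         = contradiction refl c≢c′
  go _    (here refl)         (there (here refl)) = inj₂ (refl , refl)
  go _    (there (here refl)) (here refl)         = inj₂ (refl , refl)
  go c≢c′ (there (here refl)) (there (here refl)) = contradiction refl c≢c′

oneBlue-RBEulerTrail⇒≈ᴹ : ∀ {k} {A : MG k} {e} →
  HasRBEulerTrail (A ⊎ᴿᴮ (e ∷ [])) → A ≈ᴹ (e ∷ [])
oneBlue-RBEulerTrail⇒≈ᴹ {A = A} {e} (T , E′ , flips , T↭E′ , walk)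
  with closedAltWalk-oneBlue⇒thereAndBack T walk one-blue
  where
  one-blue : #blue T ≡ 1
  one-blue = ≡.trans (#blue-↭ T↭E′) (≡.trans (≡.sym (#blue-flip flips)) (#blue-⊎ᴿᴮ A (e ∷ [])))
... | c , c′ , x , y , refl , c≢c′ = go A E′ flips T↭E′
  where
  go : ∀ A E′ → Pointwise Flip (A ⊎ᴿᴮ (e ∷ [])) E′ → T ↭ E′ → A ≈ᴹ (e ∷ [])
  go [] _ (_ ∷ []) T↭E′ = contradiction (↭-length T↭E′) λ ()
  go (_ ∷ []) ((._ , _ , _) ∷ (._ , _ , _) ∷ []) ((refl , a≈r) ∷ (refl , e≈b) ∷ []) T↭E′ =
    ≈ᵉ⇒singleton-≈ᴹ (≈ᵉ-trans a≈r (≈ᵉ-trans (thereAndBack-↭-redBlue⇒≈ᵉ c≢c′ T↭E′) (≈ᵉ-sym e≈b)))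
  go (_ ∷ _ ∷ [])    _ (_ ∷ _ ∷ _ ∷ _) T↭E′ = contradiction (↭-length T↭E′) λ ()
  go (_ ∷ _ ∷ _ ∷ _) _ (_ ∷ _ ∷ _ ∷ _) T↭E′ = contradiction (↭-length T↭E′) λ ()

doubledEdge-RBEulerTrail : ∀ {k} (a b : Fin k) → HasRBEulerTrail (((a , b) ∷ []) ⊎ᴿᴮ ((a , b) ∷ []))
doubledEdge-RBEulerTrail a b =
  thereAndBack , thereAndBack , (refl , ≈ᵉ-refl) ∷ (refl , inj₂ (refl , refl)) ∷ [] , ↭-refl ,
  ((refl , (λ ()) , tt) , refl , λ ())
  where
  thereAndBack : List (CEdge _)
  thereAndBack = (red , a , b) ∷ (blue , b , a) ∷ []

last-∷⁺ : ∀ {A : Set} (x : A) xs → last (x ∷⁺ xs) ≡ last xs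
last-∷⁺ x (y ∷ ys) with initLast ys
... | []       = refl
... | _ ∷ʳ′ _ = refl

reverseOnto : ∀ {A : Set} → List⁺ A → List A → List⁺ A
reverseOnto acc []       = acc
reverseOnto acc (x ∷ xs) = reverseOnto (x ∷⁺ acc) xs

head-reverseOnto : ∀ {A : Set} (acc : List⁺ A) xs → head (reverseOnto acc xs) ≡ last (head acc ∷ xs)
head-reverseOnto acc []       = refl
head-reverseOnto acc (x ∷ xs) =
  ≡.trans (head-reverseOnto (x ∷⁺ acc) xs) (≡.sym (last-∷⁺ (head acc) (x ∷ xs)))

last-reverseOnto : ∀ {A : Set} (acc : List⁺ A) xs → last (reverseOnto acc xs) ≡ last acc
last-reverseOnto acc []       = refl
last-reverseOnto acc (x ∷ xs) = ≡.trans (last-reverseOnto (x ∷⁺ acc) xs) (last-∷⁺ x acc)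

reverseOnto-↭ : ∀ {A : Set} (acc : List⁺ A) xs → toList (reverseOnto acc xs) ↭ toList acc ++ xs
reverseOnto-↭ acc []       = ↭-reflexive (≡.sym (++-identityʳ (toList acc)))
reverseOnto-↭ acc (x ∷ xs) = ↭-trans (reverseOnto-↭ (x ∷⁺ acc) xs) (↭-sym (shift x (toList acc) xs))

reverseOnto-linked : ∀ {A : Set} {R : A → A → Set} → (∀ {x y} → R x y → R y x) →
  (acc : List⁺ A) (xs : List A) → Linked R (toList acc) → Linked R (head acc ∷ xs) →
  Linked R (toList (reverseOnto acc xs))
reverseOnto-linked R-sym acc []       acc-linked _                  = acc-linked
reverseOnto-linked R-sym acc (x ∷ xs) acc-linked (Rhx ∷ xs-linked) =
  reverseOnto-linked R-sym (x ∷⁺ acc) xs (R-sym Rhx ∷ acc-linked) xs-linked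

hamPath-sym : ∀ {n} {G : Graph n} {u v} → HamPath G u v → HamPath G v u
hamPath-sym {G = G} (x ∷ xs , path , cover , refl , refl) =
  reverseOnto (x ∷ []) xs ,
  reverseOnto-linked (Graph.sym G) (x ∷ []) xs [-] path ,
  ↭-trans (reverseOnto-↭ (x ∷ []) xs) cover ,
  head-reverseOnto (x ∷ []) xs ,
  last-reverseOnto (x ∷ []) xs

singlePathPacking⇒hamPath : ∀ {n} {G : Graph n} {p} →
  IsPacking G (p ∷ []) → HamPath G (head p) (last p)
singlePathPacking⇒hamPath {p = p} (path ∷ [] , cover) =
  p , path , subst (_↭ allFin _) (++-identityʳ (toList p)) cover , refl , refl

hamPath⇒edge∈aux : ∀ {n k} {G : Graph n} {lab : Labelling n k} {u v a b} →
  a ∈ lab u → b ∈ lab v → HamPath G u v → InAux G lab ((a , b) ∷ [])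
hamPath⇒edge∈aux {a = a} {b} a∈ b∈ (p , path , cover , refl , refl) =
  p ∷ [] , (a , b) ∷ [] ,
  (path ∷ [] , subst (_↭ allFin _) (≡.sym (++-identityʳ (toList p))) cover) ,
  (a∈ , b∈) ∷ [] , λ _ _ → refl

aux-≈ᴹ-edge⇒hamPath : ∀ {n k} {G : Graph n} {lab : Labelling n k} {M a b} →
  InAux G lab M → M ≈ᴹ ((a , b) ∷ []) →
  Σ (Fin n) λ x → Σ (Fin n) λ y → HamPath G x y × a ∈ lab x × b ∈ lab y
aux-≈ᴹ-edge⇒hamPath {G = G} (_ , φ , _ , _ , φ≈M) M≈ab
  with ≈ᴹ-singleton-inv {φ = φ} (λ c d → ≡.trans (φ≈M c d) (M≈ab c d))
aux-≈ᴹ-edge⇒hamPath {G = G} (p ∷ [] , _ , packing , (a∈ , b∈) ∷ [] , _) _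
  | _ , refl , inj₁ (refl , refl) =
  head p , last p , singlePathPacking⇒hamPath {G = G} packing , a∈ , b∈
aux-≈ᴹ-edge⇒hamPath {G = G} (p ∷ [] , _ , packing , (b∈ , a∈) ∷ [] , _) _
  | _ , refl , inj₂ (refl , refl) =
  last p , head p , hamPath-sym {G = G} (singlePathPacking⇒hamPath {G = G} packing) , a∈ , b∈

module _ {n k} {lab : Labelling n k} {u v ℓu ℓv} (lc : LabelCond lab u v ℓu ℓv) where

  ℓu∈⇒≡u : ∀ {w} → ℓu ∈ lab w → w ≡ u
  ℓu∈⇒≡u {w} ℓu∈ with w ≟ u | w ≟ v
  ... | yes w≡u | _       = w≡u
  ... | no _    | yes w≡v = contradiction ℓu∈ (lc w .proj₂ .proj₁ w≡v .proj₂)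
  ... | no w≢u  | no w≢v  = contradiction ℓu∈ (lc w .proj₂ .proj₂ w≢u w≢v .proj₁)

  ℓv∈⇒≡v : ∀ {w} → ℓv ∈ lab w → w ≡ v
  ℓv∈⇒≡v {w} ℓv∈ with w ≟ v | w ≟ u
  ... | yes w≡v | _       = w≡v
  ... | no _    | yes w≡u = contradiction ℓv∈ (lc w .proj₁ w≡u .proj₂)
  ... | no w≢v  | no w≢u  = contradiction ℓv∈ (lc w .proj₂ .proj₂ w≢u w≢v .proj₂)

mainTheorem10 : ∀ {n k} (G : Graph n) (lab : Labelling n k) (u v : Fin n) (ℓu ℓv : Fin k) →
    ℓu ≢ ℓv → LabelCond lab u v ℓu ℓv →
    (𝓐 : MG k → Set) → (∀ M → 𝓐 M → InAux G lab M) → 𝓐 ≲ InAux G lab →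
    HamPath G u v ⇔ (Σ (MG k) λ M → 𝓐 M × M ≈ᴹ ((ℓu , ℓv) ∷ []))
mainTheorem10 G lab u v ℓu ℓv _ lc 𝓐 𝓐⊆aux 𝓐≲aux = mk⇔ forward backward
  where
  ℓuℓv : MG _
  ℓuℓv = (ℓu , ℓv) ∷ []

  forward : HamPath G u v → Σ (MG _) λ M → 𝓐 M × M ≈ᴹ ℓuℓv
  forward ham =
    let ℓu∈ = lc u .proj₁ refl .proj₁
        ℓv∈ = lc v .proj₂ .proj₁ refl .proj₁
        ℓuℓv∈aux = hamPath⇒edge∈aux {G = G} {lab} ℓu∈ ℓv∈ ham
        A , A∈𝓐 , trail = 𝓐≲aux ℓuℓv (ℓuℓv , ℓuℓv∈aux , doubledEdge-RBEulerTrail ℓu ℓv)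
    in A , A∈𝓐 , oneBlue-RBEulerTrail⇒≈ᴹ {A = A} trail

  backward : (Σ (MG _) λ M → 𝓐 M × M ≈ᴹ ℓuℓv) → HamPath G u v
  backward (M , M∈𝓐 , M≈ℓuℓv) =
    let x , y , ham , ℓu∈ , ℓv∈ = aux-≈ᴹ-edge⇒hamPath {G = G} {lab} {M} (𝓐⊆aux M M∈𝓐) M≈ℓuℓv
    in subst₂ (HamPath G) (ℓu∈⇒≡u lc ℓu∈) (ℓv∈⇒≡v lc ℓv∈) ham
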